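{- Let $\mathbb{F}_q$ be a finite field of characteristic $p$, $z\in\mathbb{F}_q$, and let $m$ be a positive integer with $m\not\equiv 0\pmod p$ and $m\not\equiv 1\pmod p$. Then $$\tilde{P}_m(z)=\frac{1}{q}\binom{q+m-2}{m}.$$
   Context: $\tilde{P}_m(z)$ denotes the number of multisets of $m$ elements of $\mathbb{F}_q^*=\mathbb{F}_q\setminus\{0\}$ (repetitions allowed) whose sum is $z$ (partitions of $z$ into $m$ parts). -}

module Defs where

open import Level using (0ℓ)
open import Algebra.Bundles using (CommutativeRing)
open import Data.Nat using (ℕ; zero; suc; _∸_)
open import Data.Nat.Base using (_≡ᵇ_)
open import Data.Bool using (Bool; true; false; _∧_; if_then_else_)
open import Data.Fin using (Fin)
open import Data.Vec using (Vec; []; _∷_; lookup; allFin; foldr; zipWith; toList)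
open import Data.List using (List; []; _∷_; [_]; map; concatMap; upTo; length; filterᵇ)
open import Data.Bool.ListAction using (all)
open import Data.Product using (∃; _,_)
open import Relation.Nullary using (¬_; Dec; does)
open import Relation.Binary.Definitions using (Decidable)
open import Relation.Binary.PropositionalEquality using (_≡_)

record FiniteField : Set₁ where
  field
    commRing : CommutativeRing 0ℓ 0ℓ
  open CommutativeRing commRing public hiding (ring)
  field
    _≟_ : Decidable _≈_
    1≉0 : ¬ (1# ≈ 0#)
    inverse : ∀ x → ¬ (x ≈ 0#) → ∃ λ y → x * y ≈ 1#
    q : ℕ
    enum : Fin q → Carrier
    enum-injective : ∀ i j → enum i ≈ enum j → i ≡ j
    enum-surjective : ∀ x → ∃ λ i → enum i ≈ x

module _ (F : FiniteField) where
  open FiniteField F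

  natCast : ℕ → Carrier
  natCast zero = 0#
  natCast (suc n) = 1# + natCast n

  HasCharacteristic : ℕ → Set
  HasCharacteristic p = natCast p ≈ 0#

  compositions : (n m : ℕ) → List (Vec ℕ n)
  compositions zero zero = [ [] ]
  compositions zero (suc m) = []
  compositions (suc n) m =
    concatMap (λ k → map (k ∷_) (compositions n (m ∸ k))) (upTo (suc m))

  -- a multiset of m elements of F is a multiplicity vector c (c i = multiplicity
  -- of enum i) with total multiplicity m; it lies in F* iff 0 has multiplicity 0
  avoidsZero : Vec ℕ q → Bool
  avoidsZero c = all (λ i → if does (enum i ≟ 0#) then lookup c i ≡ᵇ 0 else true)
                     (toList (allFin q))

  nscale : ℕ → Carrier → Carrier
  nscale zero x = 0#
  nscale (suc n) x = x + nscale n x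

  msum : Vec ℕ q → Carrier
  msum c = foldr (λ _ → Carrier) _+_ 0#
                 (zipWith nscale c (Data.Vec.map enum (allFin q)))

  Ptilde : ℕ → Carrier → ℕ
  Ptilde m z = length (filterᵇ (λ c → avoidsZero c ∧ does (msum c ≟ z))
                               (compositions q m))

-- Let Q_m(z) count the multisets of m elements of F (0 allowed) with sum z. A multiset of size
-- m+1 either avoids 0 or is one of size m plus a copy of 0, so Q_{m+1}(z) = P̃_{m+1}(z) + Q_m(z).
-- When p ∤ m, m is invertible in F, so shifting every element by t with m t = z - z′ is a
-- bijection between the multisets of sum z and those of sum z′: Q_m is constant in z, hence
-- q Q_m(z) = C(q+m-1, m), the number of all m-multisets. Applying this to m and m+1 and using
-- Pascal's rule yields q P̃_{m+1}(z) = C(q+m-1, m+1).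
module Submission where

open import Defs
open import Data.Nat using (ℕ; _*_; _+_; _∸_; _≥_)
open import Data.Nat.Divisibility using (_∣_)
open import Data.Nat.Primality using (Prime)
open import Data.Nat.Combinatorics using (_C_)
open import Relation.Nullary using (¬_)
open import Relation.Binary.PropositionalEquality using (_≡_)

open import Algebra.Bundles using (CommutativeRing)
open import Data.Bool using (Bool; true; false; _∧_; if_then_else_)
open import Data.Bool.ListAction using (all)
open import Data.Fin as Fin using (Fin)
open import Data.Fin.Properties using (nonZeroIndex)
open import Data.List
  using (List; []; _∷_; _++_; map; concatMap; applyUpTo; upTo; tabulate; allFin; length; filter; filterᵇ)
open import Data.List.Properties using (map-++; map-cong; map-cong-local; map-∘; length-tabulate)
open import Data.List.Membership.Propositional using (_∈_)
open import Data.List.Membership.Propositional.Properties using (∈-map⁺; ∈-filter⁺; ∈-allFin)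
open import Data.List.Membership.Propositional.Properties.WithK using (unique∧set⇒bag)
open import Data.List.Relation.Binary.BagAndSetEquality using (∼bag⇒↭)
open import Data.List.Relation.Binary.Permutation.Propositional
  using (_↭_; ↭-sym) renaming (refl to ↭-refl; prep to ↭-prep; swap to ↭-swap; trans to ↭-trans)
open import Data.List.Relation.Binary.Permutation.Propositional.Properties using () renaming (map⁺ to ↭-map⁺)
open import Data.List.Relation.Unary.All as All using (All)
open import Data.List.Relation.Unary.All.Properties using (all-filter)
open import Data.List.Relation.Unary.AllPairs using (_∷_)
open import Data.List.Relation.Unary.Any using (here; there)
open import Data.List.Relation.Unary.Unique.Propositional.Properties
  using (allFin⁺; filter⁺) renaming (map⁺ to unique-map⁺)
open import Data.Maybe using (nothing)
open import Data.Nat using (zero; suc; _≤_; z≤n; s≤s; NonZero; _≡ᵇ_)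
open import Data.Nat.Combinatorics using (nCn≡1; nCk+nC[k+1]≡[n+1]C[k+1])
open import Data.Nat.Coprimality using (Coprime; coprime-Bézout)
open import Data.Nat.GCD using (module Bézout)
open import Data.Nat.ListAction using (sum)
open import Data.Nat.ListAction.Properties using (sum-++; sum-↭)
open import Data.Nat.Primality using (prime⇒irreducible)
import Data.Nat.Properties as ℕ
open import Data.Product using (∃; _,_; proj₁; proj₂)
open import Data.Sum using (inj₁; inj₂)
import Data.Vec as Vec
open import Function using (_∘_; id; _⇔_; mk⇔)
open import Relation.Binary.PropositionalEquality
  using (refl; sym; trans; cong; cong₂; subst; module ≡-Reasoning)
import Relation.Binary.Reasoning.Setoid
open import Relation.Nullary using (does; yes; no; contradiction)
open import Relation.Nullary.Decidable using (¬?; does-⇔; dec-true; dec-false)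
open import Tactic.RingSolver using (solve-∀)
open import Tactic.RingSolver.Core.AlmostCommutativeRing using (AlmostCommutativeRing; fromCommutativeRing)

open import Algebra.Properties.CommutativeSemigroup ℕ.+-commutativeSemigroup using (interchange; xy∙z≈xz∙y)
open Bézout using (+-; -+)

∑≤ : ℕ → (ℕ → ℕ) → ℕ
∑≤ zero    f = f 0
∑≤ (suc m) f = f 0 + ∑≤ m (f ∘ suc)

syntax ∑≤ m (λ k → e) = ∑[ k ≤ m ] e

∑≤-cong : ∀ m {f g : ℕ → ℕ} → (∀ k → k ≤ m → f k ≡ g k) → ∑≤ m f ≡ ∑≤ m g
∑≤-cong zero    f≡g = f≡g 0 z≤n
∑≤-cong (suc m) f≡g = cong₂ _+_ (f≡g 0 z≤n) (∑≤-cong m (λ k k≤m → f≡g (suc k) (s≤s k≤m)))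

∑≤-zero : ∀ m → ∑[ k ≤ m ] 0 ≡ 0
∑≤-zero zero    = refl
∑≤-zero (suc m) = ∑≤-zero m

∑≤-+ : ∀ m (f g : ℕ → ℕ) → ∑≤ m f + ∑≤ m g ≡ ∑[ k ≤ m ] (f k + g k)
∑≤-+ zero    f g = refl
∑≤-+ (suc m) f g = begin
  (f 0 + ∑≤ m (f ∘ suc)) + (g 0 + ∑≤ m (g ∘ suc))  ≡⟨ interchange (f 0) _ (g 0) _ ⟩
  (f 0 + g 0) + (∑≤ m (f ∘ suc) + ∑≤ m (g ∘ suc))  ≡⟨ cong (f 0 + g 0 +_) (∑≤-+ m (f ∘ suc) (g ∘ suc)) ⟩
  (f 0 + g 0) + ∑[ k ≤ m ] (f (suc k) + g (suc k)) ∎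
  where open ≡-Reasoning

if-∑≤ : ∀ b m (f : ℕ → ℕ) → (if b then ∑≤ m f else 0) ≡ ∑[ k ≤ m ] (if b then f k else 0)
if-∑≤ true  m f = refl
if-∑≤ false m f = sym (∑≤-zero m)

∑≤-triangle : ∀ m (f : ℕ → ℕ → ℕ) →
  ∑[ k ≤ m ] ∑[ l ≤ m ∸ k ] f k l ≡ ∑[ l ≤ m ] ∑[ k ≤ m ∸ l ] f k l
∑≤-triangle zero          f = refl
∑≤-triangle (suc zero)    f = xy∙z≈xz∙y (f 0 0) (f 0 1) (f 1 0)
∑≤-triangle (suc (suc n)) f = begin
  (f 0 0 + A) + ∑[ k ≤ suc n ] ∑[ l ≤ suc n ∸ k ] f (suc k) l
    ≡⟨ cong (f 0 0 + A +_) (∑≤-triangle (suc n) (f ∘ suc)) ⟩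
  (f 0 0 + A) + (B + ∑[ l ≤ n ] ∑[ k ≤ n ∸ l ] f (suc k) (suc l))
    ≡⟨ cong (λ x → f 0 0 + A + (B + x)) (sym (∑≤-triangle n (λ k l → f (suc k) (suc l)))) ⟩
  (f 0 0 + A) + (B + ∑[ k ≤ n ] ∑[ l ≤ n ∸ k ] f (suc k) (suc l))
    ≡⟨ interchange (f 0 0) A B _ ⟩
  (f 0 0 + B) + ∑[ k ≤ suc n ] ∑[ l ≤ suc n ∸ k ] f k (suc l)
    ≡⟨ cong (f 0 0 + B +_) (∑≤-triangle (suc n) (λ k l → f k (suc l))) ⟩
  (f 0 0 + B) + ∑[ l ≤ suc n ] ∑[ k ≤ suc n ∸ l ] f k (suc l) ∎
  where
  open ≡-Reasoning
  A B : ℕ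
  A = ∑[ l ≤ suc n ] f 0 (suc l)
  B = ∑[ k ≤ suc n ] f (suc k) 0

multichoose : ℕ → ℕ → ℕ
multichoose zero    zero    = 1
multichoose zero    (suc m) = 0
multichoose (suc n) m       = ∑[ k ≤ m ] multichoose n (m ∸ k)

multichoose-suc : ∀ n m → multichoose (suc n) m ≡ (n + m) C m
multichoose-suc zero          zero    = refl
multichoose-suc zero          (suc m) = trans (multichoose-suc zero m) (trans (nCn≡1 m) (sym (nCn≡1 (suc m))))
multichoose-suc (suc n)       zero    = multichoose-suc n zero
multichoose-suc (suc n)       (suc m) = begin
  multichoose (suc n) (suc m) + multichoose (suc (suc n)) m
    ≡⟨ cong₂ _+_ (multichoose-suc n (suc m)) (multichoose-suc (suc n) m) ⟩
  (n + suc m) C suc m + suc (n + m) C m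
    ≡⟨ cong (λ x → (n + suc m) C suc m + x C m) (sym (ℕ.+-suc n m)) ⟩
  (n + suc m) C suc m + (n + suc m) C m
    ≡⟨ ℕ.+-comm ((n + suc m) C suc m) _ ⟩
  (n + suc m) C m + (n + suc m) C suc m
    ≡⟨ nCk+nC[k+1]≡[n+1]C[k+1] (n + suc m) m ⟩
  suc (n + suc m) C suc m ∎
  where open ≡-Reasoning

multichoose-pascal : ∀ n m → .{{NonZero n}} → multichoose n (suc m) ≡ (n + suc m ∸ 2) C suc m + multichoose n m
multichoose-pascal (suc n) m = begin
  multichoose (suc n) (suc m)           ≡⟨ multichoose-suc n (suc m) ⟩
  (n + suc m) C suc m                   ≡⟨ cong (_C suc m) (ℕ.+-suc n m) ⟩
  suc (n + m) C suc m                   ≡⟨ nCk+nC[k+1]≡[n+1]C[k+1] (n + m) m ⟨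
  (n + m) C m + (n + m) C suc m         ≡⟨ ℕ.+-comm ((n + m) C m) _ ⟩
  (n + m) C suc m + (n + m) C m         ≡⟨ cong₂ (λ x y → (x ∸ 1) C suc m + y) (ℕ.+-suc n m) (multichoose-suc n m) ⟨
  (n + suc m ∸ 1) C suc m + multichoose (suc n) m ∎
  where open ≡-Reasoning

∸-∸-comm : ∀ m k l → (m ∸ k) ∸ l ≡ (m ∸ l) ∸ k
∸-∸-comm m k l = trans (ℕ.∸-+-assoc m k l) (trans (cong (m ∸_) (ℕ.+-comm k l)) (sym (ℕ.∸-+-assoc m l k)))

if-if-comm : ∀ b c (n : ℕ) → (if b then (if c then n else 0) else 0) ≡ (if c then (if b then n else 0) else 0)
if-if-comm true  c     n = refl
if-if-comm false true  n = refl
if-if-comm false false n = refl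

if-∧-∧ : ∀ b c {d d′} → d ≡ d′ → (if (b ∧ c) ∧ d then 1 else 0) ≡ (if b then (if c ∧ d′ then 1 else 0) else 0)
if-∧-∧ true  c d≡d′ = cong (λ d → if c ∧ d then 1 else 0) d≡d′
if-∧-∧ false c d≡d′ = refl

∀ᶠ : ∀ {n} → (Fin n → Bool) → Bool
∀ᶠ {zero}  p = true
∀ᶠ {suc n} p = p Fin.zero ∧ ∀ᶠ (p ∘ Fin.suc)

admissible : ∀ {I : Set} {n} → (I → ℕ → Bool) → (Fin n → I) → Vec.Vec ℕ n → Bool
admissible a f c = ∀ᶠ (λ j → a (f j) (Vec.lookup c j))

all-toList-tabulate : ∀ {A : Set} {n} (p : A → Bool) (g : Fin n → A) → all p (Vec.toList (Vec.tabulate g)) ≡ ∀ᶠ (p ∘ g)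
all-toList-tabulate {n = zero}  p g = refl
all-toList-tabulate {n = suc n} p g = cong (p (g Fin.zero) ∧_) (all-toList-tabulate p (g ∘ Fin.suc))

module _ {A : Set} where

  sum-map-const : ∀ (xs : List A) c → sum (map (λ _ → c) xs) ≡ length xs * c
  sum-map-const []       c = refl
  sum-map-const (x ∷ xs) c = cong (c +_) (sum-map-const xs c)

  sum-map-if : ∀ b (h : A → ℕ) xs → sum (map (λ x → if b then h x else 0) xs) ≡ (if b then sum (map h xs) else 0)
  sum-map-if true  h xs = refl
  sum-map-if false h xs = trans (sum-map-const xs 0) (ℕ.*-zeroʳ (length xs))

  sum-map-∑≤ : ∀ m (h : A → ℕ → ℕ) xs → sum (map (λ x → ∑≤ m (h x)) xs) ≡ ∑[ k ≤ m ] sum (map (λ x → h x k) xs)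
  sum-map-∑≤ m h []       = sym (∑≤-zero m)
  sum-map-∑≤ m h (x ∷ xs) = trans (cong (∑≤ m (h x) +_) (sum-map-∑≤ m h xs)) (∑≤-+ m (h x) _)

  sum-map-applyUpTo : ∀ (h : A → ℕ) (g : ℕ → A) m → sum (map h (applyUpTo g (suc m))) ≡ ∑[ k ≤ m ] h (g k)
  sum-map-applyUpTo h g zero    = ℕ.+-identityʳ (h (g 0))
  sum-map-applyUpTo h g (suc m) = cong (h (g 0) +_) (sum-map-applyUpTo h (g ∘ suc) m)

  length-filterᵇ : ∀ (p : A → Bool) xs → length (filterᵇ p xs) ≡ sum (map (λ x → if p x then 1 else 0) xs)
  length-filterᵇ p []       = refl
  length-filterᵇ p (x ∷ xs) with p x
  ... | true  = cong suc (length-filterᵇ p xs)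
  ... | false = length-filterᵇ p xs

  sum-map-concatMap : ∀ {B : Set} (h : A → ℕ) (G : B → List A) ys →
    sum (map h (concatMap G ys)) ≡ sum (map (λ y → sum (map h (G y))) ys)
  sum-map-concatMap h G []       = refl
  sum-map-concatMap h G (y ∷ ys) = begin
    sum (map h (G y ++ concatMap G ys))                ≡⟨ cong sum (map-++ h (G y) _) ⟩
    sum (map h (G y) ++ map h (concatMap G ys))        ≡⟨ sum-++ (map h (G y)) _ ⟩
    sum (map h (G y)) + sum (map h (concatMap G ys))   ≡⟨ cong (sum (map h (G y)) +_) (sum-map-concatMap h G ys) ⟩
    sum (map h (G y)) + sum (map (λ y → sum (map h (G y))) ys) ∎
    where open ≡-Reasoning

module _ {n : ℕ} where

  allFin-↭-map : (s t : Fin n → Fin n) → (∀ j → s (t j) ≡ j) → (∀ i → t (s i) ≡ i) →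
    allFin n ↭ map s (allFin n)
  allFin-↭-map s t s∘t t∘s = ∼bag⇒↭ (unique∧set⇒bag (allFin⁺ n) (unique-map⁺ s-injective (allFin⁺ n))
    (λ {j} → mk⇔ (λ _ → subst (_∈ map s (allFin n)) (s∘t j) (∈-map⁺ s (∈-allFin (t j)))) (λ _ → ∈-allFin j)))
    where
    s-injective : ∀ {i j} → s i ≡ s j → i ≡ j
    s-injective {i} {j} si≡sj = trans (sym (t∘s i)) (trans (cong t si≡sj) (t∘s j))

  others : Fin n → List (Fin n)
  others i = filter (λ j → ¬? (j Fin.≟ i)) (allFin n)

  allFin-↭-∷-others : ∀ i → allFin n ↭ i ∷ others i
  allFin-↭-∷-others i = ∼bag⇒↭ (unique∧set⇒bag (allFin⁺ n) (i∉others ∷ filter⁺ _ (allFin⁺ n))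
    (λ {j} → mk⇔ (λ _ → ∈-∷-others j) (λ _ → ∈-allFin j)))
    where
    i∉others : All (λ j → ¬ i ≡ j) (others i)
    i∉others = All.map (λ j≢i i≡j → j≢i (sym i≡j)) (all-filter _ (allFin n))
    ∈-∷-others : ∀ j → j ∈ i ∷ others i
    ∈-∷-others j with j Fin.≟ i
    ... | yes refl = here refl
    ... | no  j≢i  = there (∈-filter⁺ _ (∈-allFin j) j≢i)

prime∤⇒coprime : ∀ {p m} → Prime p → ¬ p ∣ m → Coprime p m
prime∤⇒coprime p-prime p∤m (d∣p , d∣m) with prime⇒irreducible p-prime d∣p
... | inj₁ d≡1 = d≡1
... | inj₂ refl = contradiction d∣m p∤m

module _ {c ℓ} (R : CommutativeRing c ℓ) where
  private
    ring : AlmostCommutativeRing c ℓ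
    ring = fromCommutativeRing R (λ _ → nothing)
  open AlmostCommutativeRing ring using (_≈_; _-_) renaming (_+_ to _⊕_)

  x-y-z≈x-z-y : ∀ x y z → (x - y) - z ≈ (x - z) - y
  x-y-z≈x-z-y = solve-∀ ring

  x-[y+z]-w≈x-[z+w]-y : ∀ x y z w → (x - (y ⊕ z)) - w ≈ (x - (z ⊕ w)) - y
  x-[y+z]-w≈x-[z+w]-y = solve-∀ ring

module _ {c ℓ} (R : CommutativeRing c ℓ) where
  open CommutativeRing R using (_≈_; _-_; 0#; -‿cong; +-abelianGroup; +-assoc; +-comm; +-congˡ; +-congʳ; +-identityʳ)
    renaming (_+_ to _⊕_; sym to ≈-sym; trans to ≈-trans)
  open import Algebra.Properties.AbelianGroup +-abelianGroup using (xyx⁻¹≈y; ⁻¹-anti-homo‿-; ε⁻¹≈ε)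

  x+y-x≈y : ∀ x y → (x ⊕ y) - x ≈ y
  x+y-x≈y = xyx⁻¹≈y

  x+[y-x]≈y : ∀ x y → x ⊕ (y - x) ≈ y
  x+[y-x]≈y x y = ≈-trans (≈-sym (+-assoc x y _)) (xyx⁻¹≈y x y)

  x+y-y≈x : ∀ x y → (x ⊕ y) - y ≈ x
  x+y-y≈x x y = ≈-trans (+-congʳ (+-comm x y)) (x+y-x≈y y x)

  x-y+y≈x : ∀ x y → (x - y) ⊕ y ≈ x
  x-y+y≈x x y = ≈-trans (+-comm (x - y) y) (x+[y-x]≈y y x)

  x-[x-y]≈y : ∀ x y → x - (x - y) ≈ y
  x-[x-y]≈y x y = ≈-trans (+-congˡ (⁻¹-anti-homo‿- x y)) (x+[y-x]≈y x y)

  x-0≈x : ∀ x → x - 0# ≈ x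
  x-0≈x x = ≈-trans (+-congˡ ε⁻¹≈ε) (+-identityʳ x)

  sub-congˡ : ∀ {x y y′} → y ≈ y′ → x - y ≈ x - y′
  sub-congˡ y≈y′ = +-congˡ (-‿cong y≈y′)

  x+y≈z⇔y≈z-x : ∀ x y z → (x ⊕ y ≈ z) ⇔ (y ≈ z - x)
  x+y≈z⇔y≈z-x x y z = mk⇔ (λ x+y≈z → ≈-trans (≈-sym (x+y-x≈y x y)) (+-congʳ x+y≈z))
                          (λ y≈z-x → ≈-trans (+-congˡ y≈z-x) (x+[y-x]≈y x z))

module _ (F : FiniteField) where
  open FiniteField F
    using (Carrier; _≈_; _≟_; 0#; 1#; -_; _-_; 1≉0; inverse; q; enum; enum-injective; enum-surjective;
           commRing; semiring; +-commutativeMonoid; setoid; +-congʳ; +-congˡ; *-congˡ; *-congʳ; *-assoc; zeroʳ; +-identityʳ; *-identityˡ)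
    renaming (_+_ to _⊕_; _*_ to _⊗_; sym to ≈-sym; trans to ≈-trans)
  open import Algebra.Properties.Semiring.Mult semiring using (_×_; ×-congʳ; ×-homo-+; ×-assoc-*; ×1-homo-*)
  open import Algebra.Properties.CommutativeMonoid.Mult +-commutativeMonoid using (×-distrib-+)
  module ≈-Reasoning = Relation.Binary.Reasoning.Setoid setoid

  nscale≡× : ∀ k x → nscale F k x ≡ k × x
  nscale≡× zero    x = refl
  nscale≡× (suc k) x = cong (x ⊕_) (nscale≡× k x)

  natCast≡×1# : ∀ n → natCast F n ≡ n × 1#
  natCast≡×1# zero    = refl
  natCast≡×1# (suc n) = cong (1# ⊕_) (natCast≡×1# n)

  ×≈×1#⊗ : ∀ k x → k × x ≈ (k × 1#) ⊗ x
  ×≈×1#⊗ k x = begin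
    k × x          ≈⟨ ×-congʳ k (≈-sym (*-identityˡ x)) ⟩
    k × (1# ⊗ x)   ≈⟨ ×-assoc-* k 1# x ⟨
    (k × 1#) ⊗ x   ∎
    where open ≈-Reasoning

  x-k×y≈x : ∀ k {x y} → y ≈ 0# → x - k × y ≈ x
  x-k×y≈x k {x} {y} y≈0 = ≈-trans (sub-congˡ commRing (≈-trans (×≈×1#⊗ k y) (≈-trans (*-congˡ y≈0) (zeroʳ _))))
                                  (x-0≈x commRing x)

  ×-surjective : ∀ {m} → ¬ m × 1# ≈ 0# → ∀ w → ∃ λ t → m × t ≈ w
  ×-surjective {m} m≉0 w = u ⊗ w , (begin
    m × (u ⊗ w)          ≈⟨ ×≈×1#⊗ m _ ⟩
    (m × 1#) ⊗ (u ⊗ w)   ≈⟨ *-assoc _ u w ⟨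
    ((m × 1#) ⊗ u) ⊗ w   ≈⟨ *-congʳ m×u≈1 ⟩
    1# ⊗ w               ≈⟨ *-identityˡ w ⟩
    w                    ∎)
    where
    open ≈-Reasoning
    u : Carrier
    u = proj₁ (inverse (m × 1#) m≉0)
    m×u≈1 : (m × 1#) ⊗ u ≈ 1#
    m×u≈1 = proj₂ (inverse (m × 1#) m≉0)

  ×1#≈0#⇒*×1#≈0# : ∀ c {n} → n × 1# ≈ 0# → (c * n) × 1# ≈ 0#
  ×1#≈0#⇒*×1#≈0# c {n} n≈0 = ≈-trans (×1-homo-* c n) (≈-trans (*-congˡ n≈0) (zeroʳ _))

  ×1#≈0#⇒suc×1#≉0# : ∀ {n} → n × 1# ≈ 0# → ¬ suc n × 1# ≈ 0#
  ×1#≈0#⇒suc×1#≉0# {n} n≈0 1+n≈0 = 1≉0 (begin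
    1#             ≈⟨ +-identityʳ 1# ⟨
    1# ⊕ 0#        ≈⟨ +-congˡ n≈0 ⟨
    suc n × 1#     ≈⟨ 1+n≈0 ⟩
    0#             ∎)
    where open ≈-Reasoning

  coprime⇒×1#≉0# : ∀ {a b} → Coprime a b → a × 1# ≈ 0# → ¬ b × 1# ≈ 0#
  coprime⇒×1#≉0# {a} {b} a⊥b a≈0 b≈0 with coprime-Bézout a⊥b
  ... | +- x y 1+yb≡xa = ×1#≈0#⇒suc×1#≉0# {y * b} (×1#≈0#⇒*×1#≈0# y b≈0)
                           (subst (λ n → n × 1# ≈ 0#) (sym 1+yb≡xa) (×1#≈0#⇒*×1#≈0# x a≈0))
  ... | -+ x y 1+xa≡yb = ×1#≈0#⇒suc×1#≉0# {x * a} (×1#≈0#⇒*×1#≈0# x a≈0)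
                           (subst (λ n → n × 1# ≈ 0#) (sym 1+xa≡yb) (×1#≈0#⇒*×1#≈0# y b≈0))

  prime-characteristic⇒×1#≉0# : ∀ {p n} → Prime p → HasCharacteristic F p → ¬ p ∣ n → ¬ n × 1# ≈ 0#
  prime-characteristic⇒×1#≉0# {p} p-prime char p∤n =
    coprime⇒×1#≉0# (prime∤⇒coprime p-prime p∤n) (subst (_≈ 0#) (natCast≡×1# p) char)

  unrestricted : ∀ {I : Set} → I → ℕ → Bool
  unrestricted _ _ = true

  -- count a e is m z: the number of ways to give each i in is a multiplicity k permitted by a i k,
  -- with total multiplicity m and ∑ k × e i = z.
  count : ∀ {I : Set} → (I → ℕ → Bool) → (I → Carrier) → List I → ℕ → Carrier → ℕ
  count a e []       zero    z = if does (z ≟ 0#) then 1 else 0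
  count a e []       (suc m) z = 0
  count a e (i ∷ is) m       z = ∑[ k ≤ m ] (if a i k then count a e is (m ∸ k) (z - k × e i) else 0)

  module _ {I : Set} (a : I → ℕ → Bool) (e : I → Carrier) where

    count-cong : ∀ is m {z z′} → z ≈ z′ → count a e is m z ≡ count a e is m z′
    count-cong []       zero    z≈z′ = cong (λ b → if b then 1 else 0)
      (does-⇔ (mk⇔ (≈-trans (≈-sym z≈z′)) (≈-trans z≈z′)) (_ ≟ 0#) (_ ≟ 0#))
    count-cong []       (suc m) z≈z′ = refl
    count-cong (i ∷ is) m       z≈z′ = ∑≤-cong m (λ k _ →
      cong (λ n → if a i k then n else 0) (count-cong is (m ∸ k) (+-congʳ z≈z′)))

    count-swap : ∀ i j is m z → count a e (i ∷ j ∷ is) m z ≡ count a e (j ∷ i ∷ is) m z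
    count-swap i j is m z = begin
      ∑[ k ≤ m ] (if a i k then ∑[ l ≤ m ∸ k ] term k l else 0)
        ≡⟨ ∑≤-cong m (λ k _ → if-∑≤ (a i k) (m ∸ k) (term k)) ⟩
      ∑[ k ≤ m ] ∑[ l ≤ m ∸ k ] (if a i k then term k l else 0)
        ≡⟨ ∑≤-triangle m (λ k l → if a i k then term k l else 0) ⟩
      ∑[ l ≤ m ] ∑[ k ≤ m ∸ l ] (if a i k then term k l else 0)
        ≡⟨ ∑≤-cong m (λ l _ → ∑≤-cong (m ∸ l) (λ k _ → term-comm k l)) ⟩
      ∑[ l ≤ m ] ∑[ k ≤ m ∸ l ] (if a j l then term′ l k else 0)
        ≡⟨ ∑≤-cong m (λ l _ → if-∑≤ (a j l) (m ∸ l) (term′ l)) ⟨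
      ∑[ l ≤ m ] (if a j l then ∑[ k ≤ m ∸ l ] term′ l k else 0) ∎
      where
      open ≡-Reasoning
      term : ℕ → ℕ → ℕ
      term k l = if a j l then count a e is (m ∸ k ∸ l) ((z - k × e i) - l × e j) else 0
      term′ : ℕ → ℕ → ℕ
      term′ l k = if a i k then count a e is (m ∸ l ∸ k) ((z - l × e j) - k × e i) else 0
      term-comm : ∀ k l → (if a i k then term k l else 0) ≡ (if a j l then term′ l k else 0)
      term-comm k l = trans (if-if-comm (a i k) (a j l) _) (cong (λ n → if a j l then (if a i k then n else 0) else 0)
        (trans (cong (λ n → count a e is n ((z - k × e i) - l × e j)) (∸-∸-comm m k l))
               (count-cong is (m ∸ l ∸ k) (x-y-z≈x-z-y commRing z (k × e i) (l × e j)))))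

    count-↭ : ∀ {is js} → is ↭ js → ∀ m z → count a e is m z ≡ count a e js m z
    count-↭ ↭-refl               m z = refl
    count-↭ (↭-prep i is↭js)     m z = ∑≤-cong m (λ k _ → cong (λ n → if a i k then n else 0) (count-↭ is↭js (m ∸ k) _))
    count-↭ (↭-swap {xs = is} i j is↭js) m z = trans (count-swap i j is m z) (∑≤-cong m (λ k _ →
      cong (λ n → if a j k then n else 0) (∑≤-cong (m ∸ k) (λ l _ →
        cong (λ n → if a i l then n else 0) (count-↭ is↭js (m ∸ k ∸ l) _)))))
    count-↭ (↭-trans is↭js js↭ks) m z = trans (count-↭ is↭js m z) (count-↭ js↭ks m z)

  count-map : ∀ {I J : Set} (a : I → ℕ → Bool) (e : I → Carrier) (σ : J → I) is m z →
    count a e (map σ is) m z ≡ count (a ∘ σ) (e ∘ σ) is m z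
  count-map a e σ []       zero    z = refl
  count-map a e σ []       (suc m) z = refl
  count-map a e σ (j ∷ js) m       z = ∑≤-cong m (λ k _ →
    cong (λ n → if a (σ j) k then n else 0) (count-map a e σ js (m ∸ k) _))

  count-cong-elem : ∀ {I : Set} (a : I → ℕ → Bool) {e e′ : I → Carrier} → (∀ i → e i ≈ e′ i) →
    ∀ is m z → count a e is m z ≡ count a e′ is m z
  count-cong-elem a         e≈e′ []       zero    z = refl
  count-cong-elem a         e≈e′ []       (suc m) z = refl
  count-cong-elem a {e} {e′} e≈e′ (i ∷ is) m       z = ∑≤-cong m (λ k _ →
    cong (λ n → if a i k then n else 0) (trans (count-cong-elem a e≈e′ is (m ∸ k) _)
      (count-cong a e′ is (m ∸ k) (sub-congˡ commRing (×-congʳ k (e≈e′ i))))))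

  count-cong-allowed : ∀ {I : Set} {a a′ : I → ℕ → Bool} (e : I → Carrier) {is} →
    All (λ i → ∀ k → a i k ≡ a′ i k) is → ∀ m z → count a e is m z ≡ count a′ e is m z
  count-cong-allowed e All.[]                zero    z = refl
  count-cong-allowed e All.[]                (suc m) z = refl
  count-cong-allowed e (a≡a′ All.∷ as≡as′) m       z = ∑≤-cong m (λ k _ →
    cong₂ (λ b n → if b then n else 0) (a≡a′ k) (count-cong-allowed e as≡as′ (m ∸ k) _))

  count-translate : ∀ {I : Set} (e : I → Carrier) t is m z →
    count unrestricted (λ i → e i ⊕ t) is m z ≡ count unrestricted e is m (z - m × t)
  count-translate e t []       zero    z = count-cong unrestricted e [] 0 (≈-sym (x-0≈x commRing z))
  count-translate e t []       (suc m) z = refl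
  count-translate e t (i ∷ is) m       z = ∑≤-cong m (λ k k≤m →
    trans (count-translate e t is (m ∸ k) _) (count-cong unrestricted e is (m ∸ k) (shift k k≤m)))
    where
    shift : ∀ k → k ≤ m → (z - k × (e i ⊕ t)) - (m ∸ k) × t ≈ (z - m × t) - k × e i
    shift k k≤m = begin
      (z - k × (e i ⊕ t)) - (m ∸ k) × t          ≈⟨ +-congʳ (sub-congˡ commRing (×-distrib-+ (e i) t k)) ⟩
      (z - (k × e i ⊕ k × t)) - (m ∸ k) × t      ≈⟨ x-[y+z]-w≈x-[z+w]-y commRing z (k × e i) (k × t) ((m ∸ k) × t) ⟩
      (z - (k × t ⊕ (m ∸ k) × t)) - k × e i      ≈⟨ +-congʳ (sub-congˡ commRing (×-homo-+ t k (m ∸ k))) ⟨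
      (z - (k + (m ∸ k)) × t) - k × e i          ≡⟨ cong (λ n → (z - n × t) - k × e i) (ℕ.m+[n∸m]≡n k≤m) ⟩
      (z - m × t) - k × e i                      ∎
      where open ≈-Reasoning

  count-∷-≈0# : ∀ {I : Set} (e : I → Carrier) i is m z → e i ≈ 0# →
    count unrestricted e (i ∷ is) (suc m) z ≡ count unrestricted e is (suc m) z + count unrestricted e (i ∷ is) m z
  count-∷-≈0# e i is m z ei≈0 = cong₂ _+_
    (count-cong unrestricted e is (suc m) (x-0≈x commRing z))
    (∑≤-cong m (λ k _ → count-cong unrestricted e is (m ∸ k)
      (≈-trans (x-k×y≈x (suc k) ei≈0) (≈-sym (x-k×y≈x k ei≈0)))))

  private
    absent-head : ∀ {I : Set} (a : I → ℕ → Bool) (e : I → Carrier) i is m z → (∀ k → a i k ≡ (k ≡ᵇ 0)) →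
      (if a i 0 then count a e is m (z - 0 × e i) else 0) ≡ count a e is m z
    absent-head a e i is m z only-0 = trans (cong (λ b → if b then count a e is m (z - 0#) else 0) (only-0 0))
                                           (count-cong a e is m (x-0≈x commRing z))

  count-∷-absent : ∀ {I : Set} (a : I → ℕ → Bool) (e : I → Carrier) i is m z →
    (∀ k → a i k ≡ (k ≡ᵇ 0)) → count a e (i ∷ is) m z ≡ count a e is m z
  count-∷-absent a e i is zero    z only-0 = absent-head a e i is 0 z only-0
  count-∷-absent a e i is (suc m) z only-0 = begin
    first + ∑[ k ≤ m ] (if a i (suc k) then count a e is (m ∸ k) (z - suc k × e i) else 0)
      ≡⟨ cong (first +_) (∑≤-cong m (λ k _ → cong (λ b → if b then count a e is (m ∸ k) (z - suc k × e i) else 0) (only-0 (suc k)))) ⟩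
    first + ∑[ k ≤ m ] 0
      ≡⟨ cong₂ _+_ (absent-head a e i is (suc m) z only-0) (∑≤-zero m) ⟩
    count a e is (suc m) z + 0
      ≡⟨ ℕ.+-identityʳ _ ⟩
    count a e is (suc m) z ∎
    where
    open ≡-Reasoning
    first : ℕ
    first = if a i 0 then count a e is (suc m) (z - 0 × e i) else 0

  index : Carrier → Fin q
  index x = proj₁ (enum-surjective x)

  enum-index : ∀ x → enum (index x) ≈ x
  enum-index x = proj₂ (enum-surjective x)

  translate : Carrier → Fin q → Fin q
  translate c i = index (enum i ⊕ c)

  enum-translate : ∀ c i → enum (translate c i) ≈ enum i ⊕ c
  enum-translate c i = enum-index (enum i ⊕ c)

  allFin-↭-translate : ∀ c → allFin q ↭ map (translate c) (allFin q)
  allFin-↭-translate c = allFin-↭-map (translate c) (translate (- c))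
    (λ i → enum-injective _ _ (≈-trans (enum-translate c _)
      (≈-trans (+-congʳ (enum-translate (- c) i)) (x-y+y≈x commRing (enum i) c))))
    (λ i → enum-injective _ _ (≈-trans (enum-translate (- c) _)
      (≈-trans (+-congʳ (enum-translate c i)) (x+y-y≈x commRing (enum i) c))))

  fieldSum : (Carrier → ℕ) → ℕ
  fieldSum h = sum (map (h ∘ enum) (allFin q))

  fieldSum-translate : ∀ c (h : Carrier → ℕ) → (∀ {x y} → x ≈ y → h x ≡ h y) →
    fieldSum (λ x → h (x - c)) ≡ fieldSum h
  fieldSum-translate c h h-cong = begin
    sum (map (λ i → h (enum i - c)) (allFin q))
      ≡⟨ cong sum (map-cong (λ i → h-cong (≈-sym (enum-translate (- c) i))) (allFin q)) ⟩
    sum (map (h ∘ enum ∘ translate (- c)) (allFin q))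
      ≡⟨ cong sum (map-∘ {g = h ∘ enum} {f = translate (- c)} (allFin q)) ⟩
    sum (map (h ∘ enum) (map (translate (- c)) (allFin q)))
      ≡⟨ sum-↭ (↭-map⁺ (h ∘ enum) (↭-sym (allFin-↭-translate (- c)))) ⟩
    fieldSum h ∎
    where open ≡-Reasoning

  fieldSum-const : ∀ n → fieldSum (λ _ → n) ≡ q * n
  fieldSum-const n = trans (sum-map-const (allFin q) n) (cong (_* n) (length-tabulate {n = q} id))

  zeroIndex : Fin q
  zeroIndex = index 0#

  enum-others-nonzero : All (λ j → ¬ enum j ≈ 0#) (others zeroIndex)
  enum-others-nonzero = All.map (λ {j} j≢zeroIndex ej≈0 →
      j≢zeroIndex (enum-injective j zeroIndex (≈-trans ej≈0 (≈-sym (enum-index 0#)))))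
    (all-filter _ (allFin q))

  fieldSum-isZero : fieldSum (λ x → if does (x ≟ 0#) then 1 else 0) ≡ 1
  fieldSum-isZero = begin
    fieldSum isZero
      ≡⟨ sum-↭ (↭-map⁺ (isZero ∘ enum) (allFin-↭-∷-others zeroIndex)) ⟩
    isZero (enum zeroIndex) + sum (map (isZero ∘ enum) (others zeroIndex))
      ≡⟨ cong₂ _+_ (cong (λ b → if b then 1 else 0) (dec-true (_ ≟ 0#) (enum-index 0#)))
                   (cong sum (map-cong-local (All.map (λ ej≉0 → cong (λ b → if b then 1 else 0) (dec-false (_ ≟ 0#) ej≉0))
                                                      enum-others-nonzero))) ⟩
    1 + sum (map (λ _ → 0) (others zeroIndex))
      ≡⟨ cong suc (trans (sum-map-const (others zeroIndex) 0) (ℕ.*-zeroʳ (length (others zeroIndex)))) ⟩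
    1 ∎
    where
    open ≡-Reasoning
    isZero : Carrier → ℕ
    isZero x = if does (x ≟ 0#) then 1 else 0

  count-total : ∀ {I : Set} (e : I → Carrier) is m → fieldSum (count unrestricted e is m) ≡ multichoose (length is) m
  count-total e []       zero    = fieldSum-isZero
  count-total e []       (suc m) = trans (fieldSum-const 0) (ℕ.*-zeroʳ q)
  count-total e (i ∷ is) m       = begin
    fieldSum (λ x → ∑[ k ≤ m ] count unrestricted e is (m ∸ k) (x - k × e i))
      ≡⟨ sum-map-∑≤ m (λ j k → count unrestricted e is (m ∸ k) (enum j - k × e i)) (allFin q) ⟩
    ∑[ k ≤ m ] fieldSum (λ x → count unrestricted e is (m ∸ k) (x - k × e i))
      ≡⟨ ∑≤-cong m (λ k _ → trans (fieldSum-translate (k × e i) _ (count-cong unrestricted e is (m ∸ k)))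
                                  (count-total e is (m ∸ k))) ⟩
    ∑[ k ≤ m ] multichoose (length is) (m ∸ k) ∎
    where open ≡-Reasoning

  avoidingZero : Fin q → ℕ → Bool
  avoidingZero i k = if does (enum i ≟ 0#) then k ≡ᵇ 0 else true

  Q P̃ : ℕ → Carrier → ℕ
  Q  = count unrestricted enum (allFin q)
  P̃ = count avoidingZero enum (allFin q)

  Q-uniform : ∀ {m} → ¬ m × 1# ≈ 0# → ∀ z z′ → Q m z ≡ Q m z′
  Q-uniform {m} m≉0 z z′ with ×-surjective {m} m≉0 (z - z′)
  ... | t , m×t≈z-z′ = begin
    Q m z                                                       ≡⟨ count-↭ unrestricted enum (allFin-↭-translate t) m z ⟩
    count unrestricted enum (map (translate t) (allFin q)) m z  ≡⟨ count-map unrestricted enum (translate t) (allFin q) m z ⟩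
    count unrestricted (enum ∘ translate t) (allFin q) m z      ≡⟨ count-cong-elem unrestricted (enum-translate t) (allFin q) m z ⟩
    count unrestricted (λ i → enum i ⊕ t) (allFin q) m z        ≡⟨ count-translate enum t (allFin q) m z ⟩
    Q m (z - m × t)                                             ≡⟨ count-cong unrestricted enum (allFin q) m z-m×t≈z′ ⟩
    Q m z′                                                      ∎
    where
    open ≡-Reasoning
    z-m×t≈z′ : z - m × t ≈ z′
    z-m×t≈z′ = ≈-trans (sub-congˡ commRing m×t≈z-z′) (x-[x-y]≈y commRing z z′)

  q*Q : ∀ {m} → ¬ m × 1# ≈ 0# → ∀ z → q * Q m z ≡ multichoose q m
  q*Q {m} m≉0 z = begin
    q * Q m z                          ≡⟨ fieldSum-const (Q m z) ⟨
    fieldSum (λ _ → Q m z)             ≡⟨ cong sum (map-cong (λ i → Q-uniform m≉0 z (enum i)) (allFin q)) ⟩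
    fieldSum (Q m)                     ≡⟨ count-total enum (allFin q) m ⟩
    multichoose (length (allFin q)) m  ≡⟨ cong (λ n → multichoose n m) (length-tabulate {n = q} id) ⟩
    multichoose q m                    ∎
    where open ≡-Reasoning

  Q-suc : ∀ m z → Q (suc m) z ≡ P̃ (suc m) z + Q m z
  Q-suc m z = begin
    Q (suc m) z
      ≡⟨ count-↭ unrestricted enum (allFin-↭-∷-others zeroIndex) (suc m) z ⟩
    count unrestricted enum (zeroIndex ∷ others zeroIndex) (suc m) z
      ≡⟨ count-∷-≈0# enum zeroIndex (others zeroIndex) m z (enum-index 0#) ⟩
    count unrestricted enum (others zeroIndex) (suc m) z + count unrestricted enum (zeroIndex ∷ others zeroIndex) m z
      ≡⟨ cong₂ _+_ avoiding (count-↭ unrestricted enum (allFin-↭-∷-others zeroIndex) m z) ⟨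
    P̃ (suc m) z + Q m z ∎
    where
    open ≡-Reasoning
    avoiding : P̃ (suc m) z ≡ count unrestricted enum (others zeroIndex) (suc m) z
    avoiding = begin
      P̃ (suc m) z
        ≡⟨ count-↭ avoidingZero enum (allFin-↭-∷-others zeroIndex) (suc m) z ⟩
      count avoidingZero enum (zeroIndex ∷ others zeroIndex) (suc m) z
        ≡⟨ count-∷-absent avoidingZero enum zeroIndex (others zeroIndex) (suc m) z
             (λ k → cong (λ b → if b then k ≡ᵇ 0 else true) (dec-true (_ ≟ 0#) (enum-index 0#))) ⟩
      count avoidingZero enum (others zeroIndex) (suc m) z
        ≡⟨ count-cong-allowed enum (All.map (λ ej≉0 k → cong (λ b → if b then k ≡ᵇ 0 else true) (dec-false (_ ≟ 0#) ej≉0))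
                                            enum-others-nonzero) (suc m) z ⟩
      count unrestricted enum (others zeroIndex) (suc m) z ∎

  q*P̃ : ∀ {m} → ¬ m × 1# ≈ 0# → ¬ suc m × 1# ≈ 0# → ∀ z → q * P̃ (suc m) z ≡ (q + suc m ∸ 2) C suc m
  q*P̃ {m} m≉0 1+m≉0 z = ℕ.+-cancelʳ-≡ (multichoose q m) _ _ (begin
    q * P̃ (suc m) z + multichoose q m   ≡⟨ cong (q * P̃ (suc m) z +_) (q*Q m≉0 z) ⟨
    q * P̃ (suc m) z + q * Q m z         ≡⟨ ℕ.*-distribˡ-+ q _ _ ⟨
    q * (P̃ (suc m) z + Q m z)           ≡⟨ cong (q *_) (Q-suc m z) ⟨
    q * Q (suc m) z                     ≡⟨ q*Q 1+m≉0 z ⟩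
    multichoose q (suc m)               ≡⟨ multichoose-pascal q m {{nonZeroIndex zeroIndex}} ⟩
    (q + suc m ∸ 2) C suc m + multichoose q m ∎)
    where open ≡-Reasoning

  weightedSum : ∀ {I : Set} {n} → (I → Carrier) → (Fin n → I) → Vec.Vec ℕ n → Carrier
  weightedSum e f c = Vec.foldr (λ _ → Carrier) _⊕_ 0# (Vec.zipWith (nscale F) c (Vec.map e (Vec.tabulate f)))

  module _ {I : Set} (a : I → ℕ → Bool) (e : I → Carrier) where

    admissibleWithSum : ∀ {n} → (Fin n → I) → Carrier → Vec.Vec ℕ n → ℕ
    admissibleWithSum f z c = if admissible a f c ∧ does (weightedSum e f c ≟ z) then 1 else 0

    sum-admissibleWithSum-∷ : ∀ {n} (f : Fin (suc n) → I) z k (cs : List (Vec.Vec ℕ n)) →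
      sum (map (admissibleWithSum f z) (map (k Vec.∷_) cs))
        ≡ (if a (f Fin.zero) k then sum (map (admissibleWithSum (f ∘ Fin.suc) (z - k × e (f Fin.zero))) cs) else 0)
    sum-admissibleWithSum-∷ f z k cs = begin
      sum (map (admissibleWithSum f z) (map (k Vec.∷_) cs))
        ≡⟨ cong sum (map-∘ {g = admissibleWithSum f z} {f = k Vec.∷_} cs) ⟨
      sum (map (λ c → admissibleWithSum f z (k Vec.∷ c)) cs)
        ≡⟨ cong sum (map-cong (λ c → if-∧-∧ (a (f Fin.zero) k) (admissible a (f ∘ Fin.suc) c) (shift c)) cs) ⟩
      sum (map (λ c → if a (f Fin.zero) k then admissibleWithSum (f ∘ Fin.suc) z′ c else 0) cs)
        ≡⟨ sum-map-if (a (f Fin.zero) k) (admissibleWithSum (f ∘ Fin.suc) z′) cs ⟩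
      (if a (f Fin.zero) k then sum (map (admissibleWithSum (f ∘ Fin.suc) z′) cs) else 0) ∎
      where
      open ≡-Reasoning
      z′ : Carrier
      z′ = z - k × e (f Fin.zero)
      shift : ∀ c → does ((nscale F k (e (f Fin.zero)) ⊕ weightedSum e (f ∘ Fin.suc) c) ≟ z)
                  ≡ does (weightedSum e (f ∘ Fin.suc) c ≟ z′)
      shift c rewrite nscale≡× k (e (f Fin.zero)) =
        does-⇔ (x+y≈z⇔y≈z-x commRing (k × e (f Fin.zero)) (weightedSum e (f ∘ Fin.suc) c) z)
               ((k × e (f Fin.zero) ⊕ weightedSum e (f ∘ Fin.suc) c) ≟ z) (weightedSum e (f ∘ Fin.suc) c ≟ z′)

    count-compositions : ∀ n (f : Fin n → I) m z →
      sum (map (admissibleWithSum f z) (compositions F n m)) ≡ count a e (tabulate f) m z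
    count-compositions zero    f zero    z = trans (ℕ.+-identityʳ _)
      (cong (λ b → if b then 1 else 0) (does-⇔ (mk⇔ ≈-sym ≈-sym) (0# ≟ z) (z ≟ 0#)))
    count-compositions zero    f (suc m) z = refl
    count-compositions (suc n) f m       z = begin
      sum (map (admissibleWithSum f z) (concatMap startingWith (upTo (suc m))))
        ≡⟨ sum-map-concatMap (admissibleWithSum f z) startingWith (upTo (suc m)) ⟩
      sum (map (λ k → sum (map (admissibleWithSum f z) (startingWith k))) (upTo (suc m)))
        ≡⟨ sum-map-applyUpTo (λ k → sum (map (admissibleWithSum f z) (startingWith k))) id m ⟩
      ∑[ k ≤ m ] sum (map (admissibleWithSum f z) (startingWith k))
        ≡⟨ ∑≤-cong m (λ k _ → trans (sum-admissibleWithSum-∷ f z k (compositions F n (m ∸ k)))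
             (cong (λ n → if a (f Fin.zero) k then n else 0) (count-compositions n (f ∘ Fin.suc) (m ∸ k) _))) ⟩
      ∑[ k ≤ m ] (if a (f Fin.zero) k then count a e (tabulate (f ∘ Fin.suc)) (m ∸ k) (z - k × e (f Fin.zero)) else 0) ∎
      where
      open ≡-Reasoning
      startingWith : ℕ → List (Vec.Vec ℕ (suc n))
      startingWith k = map (k Vec.∷_) (compositions F n (m ∸ k))

  Ptilde≡P̃ : ∀ m z → Ptilde F m z ≡ P̃ m z
  Ptilde≡P̃ m z = begin
    Ptilde F m z
      ≡⟨ length-filterᵇ _ (compositions F q m) ⟩
    sum (map (λ c → if avoidsZero F c ∧ does (msum F c ≟ z) then 1 else 0) (compositions F q m))
      ≡⟨ cong sum (map-cong (λ c → cong (λ b → if b ∧ does (msum F c ≟ z) then 1 else 0)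
                                        (all-toList-tabulate (λ i → avoidingZero i (Vec.lookup c i)) id))
                            (compositions F q m)) ⟩
    sum (map (admissibleWithSum avoidingZero enum id z) (compositions F q m))
      ≡⟨ count-compositions avoidingZero enum q id m z ⟩
    P̃ m z ∎
    where open ≡-Reasoning

lemma3 : (F : FiniteField) (p : ℕ) → Prime p → HasCharacteristic F p →
    (z : FiniteField.Carrier F) (m : ℕ) → m ≥ 1 → ¬ (p ∣ m) → ¬ (p ∣ (m ∸ 1)) →
    FiniteField.q F * Ptilde F m z ≡ (FiniteField.q F + m ∸ 2) C m
lemma3 F p p-prime char z (suc m) _ p∤1+m p∤m = begin
  q * Ptilde F (suc m) z   ≡⟨ cong (q *_) (Ptilde≡P̃ F (suc m) z) ⟩
  q * P̃ F (suc m) z        ≡⟨ q*P̃ F (prime-characteristic⇒×1#≉0# F p-prime char p∤m)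
                                    (prime-characteristic⇒×1#≉0# F p-prime char p∤1+m) z ⟩
  (q + suc m ∸ 2) C suc m  ∎
  where
  open ≡-Reasoning
  open FiniteField F using (q)
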